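{- Let $\frac mn$ be a positive irreducible fraction and let $\Omega$ be a finite set of positive integers. Then there are infinitely many ways to choose a positive integer $t$ and proper fractions $\frac{a_1}{b_1},\dots,\frac{a_t}{b_t}$ ($a_i,b_i$ positive integers with $a_i<b_i$) such that \[ \frac mn=\frac{a_1}{b_1}+\cdots+\frac{a_t}{b_t}+\frac1{n b_1\cdots b_t} \] is a faithful decomposition, where for each $1\le i\le t$, $b_i$ is coprime to every element of $\{b_j\}_{j\ne i}\cup\Omega$.
   Context: A decomposition of a positive rational $\frac mn$ is an expression $\frac mn=\sum_{i=1}^k\frac{\alpha_i}{\beta_i}$ with $\alpha_i$ positive integers and $\beta_i$ pairwise distinct positive integers. For a positive irreducible fraction $u=\frac mn$, it is faithful if for all integers $0\le x_i\le \alpha_i$, $v=\sum_i\frac{x_i}{\beta_i}\notin\frac1n\mathbb Z$ unless $v=u$ or $v=0$. -}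

module Defs where

open import Data.Nat using (ℕ; zero; suc; _≤_; _<_; _*_)
open import Data.Nat.Coprimality using (Coprime)
open import Data.Integer using (ℤ; +_)
open import Data.Rational using (ℚ; _/_; 0ℚ; _+_)
open import Data.Product using (_×_; _,_; proj₁; proj₂; ∃-syntax)
open import Data.Sum using (_⊎_)
open import Data.List using (List; []; _∷_; map; zipWith; foldr; length; lookup; _++_; [_])
open import Data.Nat.ListAction using (product)
open import Data.List.Relation.Unary.All using (All)
open import Data.List.Relation.Unary.Unique.Propositional using (Unique)
open import Data.List.Relation.Binary.Pointwise using (Pointwise)
open import Data.List.Membership.Propositional using (_∉_)
open import Data.Fin using (Fin)
open import Relation.Binary.PropositionalEquality using (_≡_; _≢_)

-- The rational number a / b.  Only ever used with b ≥ 1; for b = 0 we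
-- return 0 (a junk value, never reached under the hypotheses below).
frac : ℕ → ℕ → ℚ
frac a zero    = 0ℚ
frac a (suc b) = (+ a) / suc b

-- k / d for an integer k (again d ≥ 1 in all uses; junk 0 for d = 0).
fracℤ : ℤ → ℕ → ℚ
fracℤ k zero    = 0ℚ
fracℤ k (suc d) = k / suc d

value : List (ℕ × ℕ) → ℚ
value []            = 0ℚ
value ((α , β) ∷ D) = frac α β + value D

IsDecomposition : ℚ → List (ℕ × ℕ) → Set
IsDecomposition u D =
  All (λ p → 1 ≤ proj₁ p × 1 ≤ proj₂ p) D × Unique (map proj₂ D) × value D ≡ u

InOneOverNZ : ℕ → ℚ → Set
InOneOverNZ n v = ∃[ k ] v ≡ fracℤ k n

Choice : List (ℕ × ℕ) → List ℕ → Set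
Choice D xs = Pointwise (λ x p → x ≤ proj₁ p) xs D

subValue : List ℕ → List (ℕ × ℕ) → ℚ
subValue xs D = value (zipWith (λ x p → (x , proj₂ p)) xs D)

FaithfulDecomposition : ℕ → ℕ → List (ℕ × ℕ) → Set
FaithfulDecomposition m n D =
  IsDecomposition (frac m n) D ×
  (∀ xs → Choice D xs → InOneOverNZ n (subValue xs D) →
     subValue xs D ≡ frac m n ⊎ subValue xs D ≡ 0ℚ)

Infinite : {A : Set} → (A → Set) → Set
Infinite {A} P = (L : List A) → ∃[ s ] (s ∉ L × P s)

dens : List (ℕ × ℕ) → List ℕ
dens s = map proj₂ s

theDecomposition : ℕ → List (ℕ × ℕ) → List (ℕ × ℕ)
theDecomposition n s = s ++ [ (1 , n * product (dens s)) ]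

GoodChoice : ℕ → ℕ → List ℕ → List (ℕ × ℕ) → Set
GoodChoice m n Ω s =
  1 ≤ length s ×
  All (λ p → 1 ≤ proj₁ p × proj₁ p < proj₂ p) s ×
  FaithfulDecomposition m n (theDecomposition n s) ×
  (∀ (i j : Fin (length s)) → i ≢ j →
     Coprime (proj₂ (lookup s i)) (proj₂ (lookup s j))) ×
  (∀ (i : Fin (length s)) → All (λ ω → Coprime (proj₂ (lookup s i)) ω) Ω)

module Submission where

open import Defs
open import Data.Nat using (ℕ; _≤_)
open import Data.Nat.Coprimality using (Coprime)
open import Data.List using (List)
open import Data.List.Relation.Unary.All using (All)

open import Data.Nat as ℕ using (zero; suc; _+_; _*_; _∸_; _<_; z≤n; s≤s)
open import Data.Nat.Properties
open import Data.Nat.DivMod using (_/_; _%_; m≡m%n+[m/n]*n; m%n<n)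
open import Data.Nat.Divisibility
import Data.Nat.Coprimality as C
open import Data.Nat.GCD using (gcd; gcd[m,n]∣m; gcd[m,n]∣n; gcd[m,n]≢0; module Bézout)
open import Data.Nat.ListAction using (product; sum)
open import Data.Nat.ListAction.Properties using (∈⇒∣product; ∈⇒≤product; product≢0)
open import Data.Nat.Solver using (module +-*-Solver)
open import Data.Integer as ℤ using ()
import Data.Integer.Properties as ℤP
open import Data.Rational as ℚ using (0ℚ)
import Data.Rational.Properties as ℚP
open import Data.Rational.Unnormalised as ℚᵘ using (mkℚᵘ; *≡*)
import Data.Rational.Unnormalised.Properties as ℚᵘP
open import Data.Fin as Fin using (Fin)
open import Data.List using (_∷_; []; _∷ʳ_; zipWith; map; length; lookup)
open import Data.List.Properties using (map-++)
open import Data.List.Membership.Propositional using (_∈_)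
open import Data.List.Membership.Propositional.Properties using (∈-lookup)
open import Data.List.Relation.Unary.Any using (here; there)
open import Data.List.Relation.Unary.All as All using (_∷_; [])
import Data.List.Relation.Unary.All.Properties as AllP
open import Data.List.Relation.Unary.AllPairs using (AllPairs; _∷_; [])
import Data.List.Relation.Unary.AllPairs.Properties as AllPairsP
open import Data.List.Relation.Unary.Unique.Propositional using (Unique)
open import Data.List.Relation.Binary.Pointwise using (Pointwise; _∷_; [])
open import Data.Product using (_×_; _,_; proj₁; proj₂; ∃-syntax)
open import Data.Sum using (_⊎_; inj₁; inj₂)
open import Function using (_on_; _∘_; id)
open import Relation.Nullary using (yes; no; contradiction)
open import Relation.Binary.PropositionalEquality

open +-*-Solver

-- Write W = ∏ Ω and, for a partial list s with P = b₁⋯b_k, m/n − Σ aᵢ/bᵢ = E/(nP).  While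
-- E ≥ nP, subtract X/(1+X) with X = nPW, which lowers ⌊E/(nP)⌋ by one.  Once E < nP, pick
-- b ≡ E⁻¹ (mod nP) coprime to W and a = (bE − 1)/(nP): the remainder becomes 1/(nPb).  Each
-- further W/(1+X) keeps the remainder of this form, so the lists get arbitrarily long.  New
-- denominators are units modulo nP and W, which gives all the coprimality.  Faithfulness: a
-- sub-sum Σ xᵢ/bᵢ + y/(nP) with y ≤ 1 lies in (1/n)ℤ only if P ∣ n·Σ xᵢ(P/bᵢ) + y; as P ⊥ n
-- and the bᵢ are pairwise coprime with xᵢ < bᵢ, this forces either all xᵢ = 0 (y = 0) or all
-- xᵢ = aᵢ (y = 1, applied to the complementary choice aᵢ − xᵢ).

fromℚᵘ-homo-+ : ∀ p q → ℚ.fromℚᵘ (p ℚᵘ.+ q) ≡ ℚ.fromℚᵘ p ℚ.+ ℚ.fromℚᵘ q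
fromℚᵘ-homo-+ p q = sym (ℚP.toℚᵘ-injective
  (ℚᵘP.≃-trans (ℚP.toℚᵘ-homo-+ (ℚ.fromℚᵘ p) (ℚ.fromℚᵘ q))
  (ℚᵘP.≃-trans (ℚᵘP.+-cong (ℚP.toℚᵘ-fromℚᵘ p) (ℚP.toℚᵘ-fromℚᵘ q))
               (ℚᵘP.≃-sym (ℚP.toℚᵘ-fromℚᵘ (p ℚᵘ.+ q))))))

frac-+ : ∀ {a b c d} → 1 ≤ b → 1 ≤ d → frac a b ℚ.+ frac c d ≡ frac (a * d + b * c) (b * d)
frac-+ {a} {suc b} {c} {suc d} _ _ = begin
  frac a (suc b) ℚ.+ frac c (suc d)
    ≡⟨ fromℚᵘ-homo-+ (mkℚᵘ (ℤ.+ a) b) (mkℚᵘ (ℤ.+ c) d) ⟨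
  ℚ.fromℚᵘ (mkℚᵘ (ℤ.+ a) b ℚᵘ.+ mkℚᵘ (ℤ.+ c) d)
    ≡⟨ ℚP.fromℚᵘ-cong {mkℚᵘ (ℤ.+ a) b ℚᵘ.+ mkℚᵘ (ℤ.+ c) d} {mkℚᵘ (ℤ.+ (a * suc d + suc b * c)) (d + b * suc d)}
         (*≡* (cong (ℤ._* ℤ.+ (suc b * suc d)) numerators)) ⟩
  frac (a * suc d + suc b * c) (suc b * suc d) ∎
  where
  open ≡-Reasoning
  numerators : ℤ.+ a ℤ.* ℤ.+ suc d ℤ.+ ℤ.+ c ℤ.* ℤ.+ suc b ≡ ℤ.+ (a * suc d + suc b * c)
  numerators = begin
    ℤ.+ a ℤ.* ℤ.+ suc d ℤ.+ ℤ.+ c ℤ.* ℤ.+ suc b ≡⟨ cong₂ ℤ._+_ (ℤP.pos-* a (suc d)) (ℤP.pos-* c (suc b)) ⟨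
    ℤ.+ (a * suc d) ℤ.+ ℤ.+ (c * suc b)         ≡⟨ ℤP.pos-+ (a * suc d) (c * suc b) ⟨
    ℤ.+ (a * suc d + c * suc b)                 ≡⟨ cong (λ x → ℤ.+ (a * suc d + x)) (*-comm c (suc b)) ⟩
    ℤ.+ (a * suc d + suc b * c)                 ∎

frac-cross : ∀ {a b c d} → 1 ≤ b → 1 ≤ d → a * d ≡ c * b → frac a b ≡ frac c d
frac-cross {a} {suc b} {c} {suc d} _ _ ad≡cb = ℚP.fromℚᵘ-cong {mkℚᵘ (ℤ.+ a) b} {mkℚᵘ (ℤ.+ c) d}
  (*≡* (trans (sym (ℤP.pos-* a (suc d))) (trans (cong ℤ.+_ ad≡cb) (ℤP.pos-* c (suc b)))))

frac≡fracℤ⇒cross : ∀ {a b k d} → 1 ≤ b → 1 ≤ d → frac a b ≡ fracℤ k d → a * d ≡ ℤ.∣ k ∣ * b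
frac≡fracℤ⇒cross {a} {suc b} {k} {suc d} _ _ eq with ℚP.fromℚᵘ-injective {mkℚᵘ (ℤ.+ a) b} {mkℚᵘ k d} eq
... | *≡* ad≡kb = trans (sym (ℤP.abs-* (ℤ.+ a) (ℤ.+ suc d))) (trans (cong ℤ.∣_∣ ad≡kb) (ℤP.abs-* k (ℤ.+ suc b)))

frac-0 : ∀ {b} → 1 ≤ b → frac 0 b ≡ 0ℚ
frac-0 {suc b} _ = ℚP.0/n≡0 (suc b)

coprime-∣ˡ : ∀ {d m n} → d ∣ m → Coprime m n → Coprime d n
coprime-∣ˡ d∣m m⊥n (i∣d , i∣n) = m⊥n (∣-trans i∣d d∣m , i∣n)

coprime-∣ʳ : ∀ {d m n} → d ∣ n → Coprime m n → Coprime m d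
coprime-∣ʳ d∣n m⊥n = C.sym (coprime-∣ˡ d∣n (C.sym m⊥n))

coprime-*ʳ : ∀ {m n o} → Coprime m n → Coprime m o → Coprime m (n * o)
coprime-*ʳ m⊥n m⊥o (i∣m , i∣no) = m⊥o (i∣m , C.coprime-divisor (coprime-∣ˡ i∣m m⊥n) i∣no)

coprime-+-∣ : ∀ {a d t} → Coprime a d → d ∣ t → Coprime (a + t) d
coprime-+-∣ {a} {t = t} a⊥d d∣t {i} (i∣a+t , i∣d) =
  a⊥d (∣m+n∣m⇒∣n (subst (i ∣_) (+-comm a t) i∣a+t) (∣-trans i∣d d∣t) , i∣d)

≡1+⇒coprime : ∀ {x y d} → x ≡ 1 + y → d ∣ y → Coprime x d
≡1+⇒coprime {d = d} refl d∣y = coprime-+-∣ (C.1-coprimeTo d) d∣y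

coprime⇒≢ : ∀ {m n} → 2 ≤ m → Coprime m n → m ≢ n
coprime⇒≢ 2≤m m⊥m refl = <⇒≢ 2≤m (sym (m⊥m (∣-refl , ∣-refl)))

-- In the second Bézout case x E ≡ -1 (mod M), so (M - 1) x inverts E.
modularInverse : ∀ {E M} → 1 < M → Coprime E M → ∃[ u ] ∃[ v ] u * E ≡ 1 + M * v
modularInverse {M = suc zero} (s≤s ())
modularInverse {E} {suc (suc M)} _ E⊥M with C.coprime-Bézout E⊥M
... | Bézout.+- x y 1+yM≡xE = x , y , trans (sym 1+yM≡xE) (cong (1 +_) (*-comm y (2 + M)))
... | Bézout.-+ x (suc y) 1+xE≡yM = x * suc M , suc M * y + M , +-cancelʳ-≡ (suc M) _ _ (begin
  x * suc M * E + suc M                 ≡⟨ solve 3 (λ x M E → x :* (con 1 :+ M) :* E :+ (con 1 :+ M)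
                                                 := (con 1 :+ M) :* (con 1 :+ x :* E)) refl x M E ⟩
  suc M * (1 + x * E)                   ≡⟨ cong (suc M *_) 1+xE≡yM ⟩
  suc M * (suc y * (2 + M))             ≡⟨ solve 2 (λ M y → (con 1 :+ M) :* ((con 1 :+ y) :* (con 2 :+ M))
                                                 := con 1 :+ (con 2 :+ M) :* ((con 1 :+ M) :* y :+ M) :+ (con 1 :+ M)) refl M y ⟩
  1 + (2 + M) * (suc M * y + M) + suc M ∎)
  where open ≡-Reasoning

-- The fuel W suffices since W strictly decreases at every step.
coprimePartWithin : ℕ → ℕ → ℕ → ℕ
coprimePartWithin zero    W c = W
coprimePartWithin (suc k) W c with 1 <? gcd W c
... | yes _ = coprimePartWithin k (quotient (gcd[m,n]∣m W c)) c
... | no  _ = W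

coprimePart : ℕ → ℕ → ℕ
coprimePart W c = coprimePartWithin W W c

private
  quotient-pos : ∀ {d W} (d∣W : d ∣ W) → 1 ≤ W → 1 ≤ quotient d∣W
  quotient-pos d∣W 1≤W = ℕ.>-nonZero⁻¹ _ {{quotient≢0 d∣W {{ℕ.>-nonZero 1≤W}}}}

coprimePartWithin-pos : ∀ k W c → 1 ≤ W → 1 ≤ coprimePartWithin k W c
coprimePartWithin-pos zero    W c 1≤W = 1≤W
coprimePartWithin-pos (suc k) W c 1≤W with 1 <? gcd W c
... | yes _ = coprimePartWithin-pos k _ c (quotient-pos (gcd[m,n]∣m W c) 1≤W)
... | no  _ = 1≤W

coprimePartWithin-coprime : ∀ k W c → 1 ≤ W → W ≤ k → Coprime (coprimePartWithin k W c) c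
coprimePartWithin-coprime zero    W c 1≤W W≤0 = contradiction (≤-trans 1≤W W≤0) λ ()
coprimePartWithin-coprime (suc k) W c 1≤W W≤1+k with 1 <? gcd W c
... | yes 1<g = coprimePartWithin-coprime k _ c (quotient-pos (gcd[m,n]∣m W c) 1≤W)
                  (≤-pred (≤-trans (quotient-< (gcd[m,n]∣m W c) {{ℕ.n>1⇒nonTrivial 1<g}} {{ℕ.>-nonZero 1≤W}}) W≤1+k))
... | no  g≯1 = C.gcd≡1⇒coprime (≤-antisym (≮⇒≥ g≯1) (n≢0⇒n>0 (gcd[m,n]≢0 W c (inj₁ (m<n⇒n≢0 1≤W)))))

coprimePartWithin-complete : ∀ k W c {x} → Coprime x (coprimePartWithin k W c) → Coprime x c → Coprime x W
coprimePartWithin-complete zero    W c x⊥part x⊥c = x⊥part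
coprimePartWithin-complete (suc k) W c x⊥part x⊥c with 1 <? gcd W c
... | no  _ = x⊥part
... | yes _ = subst (Coprime _) (sym (m∣n⇒n≡quotient*m (gcd[m,n]∣m W c)))
                (coprime-*ʳ (coprimePartWithin-complete k _ c x⊥part x⊥c) (coprime-∣ʳ (gcd[m,n]∣n W c) x⊥c))

coprimePart-pos : ∀ W c → 1 ≤ W → 1 ≤ coprimePart W c
coprimePart-pos W = coprimePartWithin-pos W W

coprimePart-coprime : ∀ W c → 1 ≤ W → Coprime (coprimePart W c) c
coprimePart-coprime W c 1≤W = coprimePartWithin-coprime W W c 1≤W ≤-refl

coprimePart-complete : ∀ W c {x} → Coprime x (coprimePart W c) → Coprime x c → Coprime x W
coprimePart-complete W = coprimePartWithin-complete W W

-- b = u + M Y with u E ≡ 1 (mod M) and Y the part of W coprime to u: each prime of W divides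
-- exactly one of u and M Y, hence not b.
finalTerm : ∀ {E M W} → 1 ≤ E → E < M → Coprime E M → 1 ≤ W →
            ∃[ a ] ∃[ b ] 1 ≤ a × a < b × b * E ≡ 1 + M * a × Coprime b W
finalTerm {E} {M} {W} 1≤E E<M E⊥M 1≤W with modularInverse (≤-<-trans 1≤E E<M) E⊥M
... | u , v , uE≡1+Mv = a , b , 1≤a , a<b , bE≡1+Ma , b⊥W
  where
  Y = coprimePart W u
  b = u + M * Y
  a = v + Y * E
  bE≡1+Ma : b * E ≡ 1 + M * a
  bE≡1+Ma = begin
    (u + M * Y) * E       ≡⟨ *-distribʳ-+ E u (M * Y) ⟩
    u * E + M * Y * E     ≡⟨ cong (_+ M * Y * E) uE≡1+Mv ⟩
    1 + M * v + M * Y * E ≡⟨ solve 4 (λ M v Y E → con 1 :+ M :* v :+ M :* Y :* E := con 1 :+ M :* (v :+ Y :* E)) refl M v Y E ⟩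
    1 + M * (v + Y * E)   ∎
    where open ≡-Reasoning
  1≤a : 1 ≤ a
  1≤a = ≤-trans (*-mono-≤ (coprimePart-pos W u 1≤W) 1≤E) (m≤n+m (Y * E) v)
  a<b : a < b
  a<b = *-cancelˡ-< M a b (begin-strict
    M * a     <⟨ n<1+n (M * a) ⟩
    1 + M * a ≡⟨ bE≡1+Ma ⟨
    b * E     ≤⟨ *-monoʳ-≤ b (<⇒≤ E<M) ⟩
    b * M     ≡⟨ *-comm b M ⟩
    M * b     ∎)
    where open ≤-Reasoning
  u⊥M : Coprime u M
  u⊥M = coprime-∣ˡ (m∣m*n E) (≡1+⇒coprime uE≡1+Mv (m∣m*n v))
  Y⊥u : Coprime Y u
  Y⊥u = coprimePart-coprime W u 1≤W
  b⊥W : Coprime b W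
  b⊥W = coprimePart-complete W u (coprime-+-∣ (C.sym Y⊥u) (n∣m*n M))
                                 (C.coprime-+ (C.sym (coprime-*ʳ u⊥M (C.sym Y⊥u))))

filler-identity : ∀ j M X r → j * (suc X * M) + (M + suc X * r) + X * M ≡ suc X * (suc j * M + r)
filler-identity = solve 4 (λ j M X r → j :* ((con 1 :+ X) :* M) :+ (M :+ (con 1 :+ X) :* r) :+ X :* M
                                       := (con 1 :+ X) :* ((con 1 :+ j) :* M :+ r)) refl

filler-remainder-< : ∀ {M X r} → M ≤ X → r < M → M + suc X * r < suc X * M
filler-remainder-< {M} {X} {r} M≤X r<M = begin-strict
  M + suc X * r     <⟨ +-monoˡ-< (suc X * r) (s≤s M≤X) ⟩
  suc X + suc X * r ≡⟨ *-suc (suc X) r ⟨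
  suc X * suc r     ≤⟨ *-monoʳ-≤ (suc X) r<M ⟩
  suc X * M         ∎
  where open ≤-Reasoning

filler-coprime : ∀ {E E′ M X} → M ∣ X → Coprime E M → E′ + X * M ≡ suc X * E → Coprime E′ (suc X * M)
filler-coprime {E} {E′} {M} {X} M∣X E⊥M E′+XM≡[1+X]E = coprime-*ʳ E′⊥1+X E′⊥M
  where
  1+X⊥X : Coprime (suc X) X
  1+X⊥X = ≡1+⇒coprime refl ∣-refl
  E′⊥1+X : Coprime E′ (suc X)
  E′⊥1+X {i} (i∣E′ , i∣1+X) = 1+X⊥X (i∣1+X , ∣-trans i∣M M∣X)
    where
    i∣XM : i ∣ X * M
    i∣XM = ∣m+n∣m⇒∣n (subst (i ∣_) (sym E′+XM≡[1+X]E) (∣m⇒∣m*n E i∣1+X)) i∣E′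
    i∣M : i ∣ M
    i∣M = C.coprime-divisor (coprime-∣ˡ i∣1+X 1+X⊥X) i∣XM
  E′⊥M : Coprime E′ M
  E′⊥M {i} (i∣E′ , i∣M) = E⊥M (i∣E , i∣M)
    where
    i∣[1+X]E : i ∣ suc X * E
    i∣[1+X]E = subst (i ∣_) E′+XM≡[1+X]E (∣m∣n⇒∣m+n i∣E′ (∣n⇒∣m*n X i∣M))
    i∣E : i ∣ E
    i∣E = C.coprime-divisor (C.sym (coprime-∣ʳ (∣-trans i∣M M∣X) 1+X⊥X)) i∣[1+X]E

AllPairs-lookup : ∀ {A : Set} {R : A → A → Set} {xs} → (∀ {x y} → R x y → R y x) → AllPairs R xs →
                  ∀ (i j : Fin (length xs)) → i ≢ j → R (lookup xs i) (lookup xs j)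
AllPairs-lookup sym (_ ∷ _)     Fin.zero    Fin.zero    i≢j = contradiction refl i≢j
AllPairs-lookup sym (Rx ∷ _)    Fin.zero    (Fin.suc j) _   = All.lookup Rx (∈-lookup j)
AllPairs-lookup sym (Rx ∷ _)    (Fin.suc i) Fin.zero    _   = sym (All.lookup Rx (∈-lookup i))
AllPairs-lookup sym (_ ∷ pairs) (Fin.suc i) (Fin.suc j) i≢j = AllPairs-lookup sym pairs i j (i≢j ∘ cong Fin.suc)

Pointwise-∷ʳ⁻ : ∀ {A B : Set} {R : A → B → Set} ys {z xs} → Pointwise R xs (ys ∷ʳ z) →
                ∃[ xs′ ] ∃[ x ] xs ≡ xs′ ∷ʳ x × Pointwise R xs′ ys × R x z
Pointwise-∷ʳ⁻ []       (r ∷ []) = [] , _ , refl , [] , r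
Pointwise-∷ʳ⁻ (y ∷ ys) (r ∷ rs) with Pointwise-∷ʳ⁻ ys rs
... | xs′ , x , refl , rs′ , r′ = _ ∷ xs′ , x , refl , r ∷ rs′ , r′

∈⇒<product : ∀ {x y z zs} → All (2 ≤_) (y ∷ z ∷ zs) → x ∈ y ∷ z ∷ zs → x < product (y ∷ z ∷ zs)
∈⇒<product {zs = zs} (2≤y ∷ 2≤z ∷ 2≤zs) (here refl) =
  m<m*n _ _ {{ℕ.>-nonZero (≤-trans (s≤s z≤n) 2≤y)}}
    (*-mono-≤ 2≤z (ℕ.>-nonZero⁻¹ (product zs) {{product≢0 (All.map (ℕ.>-nonZero ∘ ≤-trans (s≤s z≤n)) 2≤zs)}}))
∈⇒<product {y = y} {z} {zs} (2≤y ∷ 2≤z∷zs) (there x∈z∷zs) =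
  ≤-<-trans (∈⇒≤product nonZero x∈z∷zs) (subst (product (z ∷ zs) <_) (*-comm _ y) (m<m*n _ y {{product≢0 nonZero}} 2≤y))
  where nonZero = All.map (ℕ.>-nonZero ∘ ≤-trans (s≤s z≤n)) 2≤z∷zs

∈⇒length≤sum : ∀ {A : Set} {xs : List A} {L} → xs ∈ L → length xs ≤ sum (map length L)
∈⇒length≤sum {L = ys ∷ L} (here refl)  = m≤m+n (length ys) _
∈⇒length≤sum {L = ys ∷ L} (there xs∈L) = ≤-trans (∈⇒length≤sum xs∈L) (m≤n+m _ (length ys))

unboundedLength⇒Infinite : ∀ {A : Set} {P : List A → Set} → (∀ R → ∃[ xs ] R ≤ length xs × P xs) → Infinite P
unboundedLength⇒Infinite unbounded L with unbounded (suc (sum (map length L)))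
... | xs , long , Pxs = xs , (λ xs∈L → <⇒≱ long (∈⇒length≤sum xs∈L)) , Pxs

Proper : ℕ × ℕ → Set
Proper p = proj₁ p < proj₂ p

denom : List (ℕ × ℕ) → ℕ
denom s = product (dens s)

numer : List (ℕ × ℕ) → ℕ
numer []            = 0
numer ((a , b) ∷ s) = a * denom s + b * numer s

denom-pos : ∀ {s} → All ((1 ≤_) ∘ proj₂) s → 1 ≤ denom s
denom-pos []          = ≤-refl
denom-pos (1≤b ∷ pos) = *-mono-≤ 1≤b (denom-pos pos)

value≡frac : ∀ {s} → All ((1 ≤_) ∘ proj₂) s → value s ≡ frac (numer s) (denom s)
value≡frac []                        = sym (frac-0 ≤-refl)
value≡frac {(a , b) ∷ s} (1≤b ∷ pos) = trans (cong (frac a b ℚ.+_) (value≡frac pos)) (frac-+ 1≤b (denom-pos pos))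

denom-∷ʳ : ∀ s y c → denom (s ∷ʳ (y , c)) ≡ denom s * c
denom-∷ʳ []            y c = trans (*-identityʳ c) (sym (*-identityˡ c))
denom-∷ʳ ((a , b) ∷ s) y c = trans (cong (b *_) (denom-∷ʳ s y c)) (sym (*-assoc b (denom s) c))

numer-∷ʳ : ∀ s y c → numer (s ∷ʳ (y , c)) ≡ numer s * c + denom s * y
numer-∷ʳ []            y c = solve 2 (λ y c → y :* con 1 :+ c :* con 0 := con 0 :* c :+ con 1 :* y) refl y c
numer-∷ʳ ((a , b) ∷ s) y c rewrite denom-∷ʳ s y c | numer-∷ʳ s y c =
  solve 6 (λ a P c b N y → a :* (P :* c) :+ b :* (N :* c :+ P :* y) := (a :* P :+ b :* N) :* c :+ b :* P :* y)
    refl a (denom s) c b (numer s) y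

value-∷ʳ : ∀ {s y c} → All ((1 ≤_) ∘ proj₂) s → 1 ≤ c →
           value (s ∷ʳ (y , c)) ≡ frac (numer s * c + denom s * y) (denom s * c)
value-∷ʳ {s} {y} {c} pos 1≤c = begin
  value (s ∷ʳ (y , c))                               ≡⟨ value≡frac (AllP.++⁺ pos (1≤c ∷ [])) ⟩
  frac (numer (s ∷ʳ (y , c))) (denom (s ∷ʳ (y , c))) ≡⟨ cong₂ frac (numer-∷ʳ s y c) (denom-∷ʳ s y c) ⟩
  frac (numer s * c + denom s * y) (denom s * c)     ∎
  where open ≡-Reasoning

coprime-denom : ∀ {b s} → All (Coprime b ∘ proj₂) s → Coprime b (denom s)
coprime-denom {b} []        = C.sym (C.1-coprimeTo b)
coprime-denom (b⊥c ∷ b⊥s)   = coprime-*ʳ b⊥c (coprime-denom b⊥s)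

coprime-denom⁻ : ∀ {b} s → Coprime b (denom s) → All (Coprime b ∘ proj₂) s
coprime-denom⁻ []            _    = []
coprime-denom⁻ ((a , c) ∷ s) b⊥cP = coprime-∣ʳ (m∣m*n (denom s)) b⊥cP ∷ coprime-denom⁻ s (coprime-∣ʳ (n∣m*n c) b⊥cP)

coprime⇒distinct : ∀ {s : List (ℕ × ℕ)} → All ((2 ≤_) ∘ proj₂) s → AllPairs (Coprime on proj₂) s →
                   AllPairs _≢_ (dens s)
coprime⇒distinct []          []              = []
coprime⇒distinct (2≤b ∷ 2≤s) (b⊥s ∷ coprime) = AllP.map⁺ (All.map (coprime⇒≢ 2≤b) b⊥s) ∷ coprime⇒distinct 2≤s coprime

private
  ∣-<⇒≡0 : ∀ {a b} → b ∣ a → a < b → a ≡ 0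
  ∣-<⇒≡0 {zero}  _   _   = refl
  ∣-<⇒≡0 {suc a} b∣a a<b = contradiction (∣⇒≤ b∣a) (<⇒≱ a<b)

denom∣numer⇒numer≡0 : ∀ s → All Proper s → AllPairs (Coprime on proj₂) s → denom s ∣ numer s → numer s ≡ 0
denom∣numer⇒numer≡0 []            _              _               _    = refl
denom∣numer⇒numer≡0 ((a , b) ∷ s) (a<b ∷ proper) (b⊥s ∷ coprime) bP∣N = begin
  a * P + b * N ≡⟨ cong₂ (λ a N → a * P + b * N) a≡0 N≡0 ⟩
  b * 0         ≡⟨ *-zeroʳ b ⟩
  0             ∎
  where
  open ≡-Reasoning
  P = denom s
  N = numer s
  P∣bN : P ∣ b * N
  P∣bN = ∣m+n∣m⇒∣n (∣-trans (n∣m*n b) bP∣N) (n∣m*n a)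
  N≡0 : N ≡ 0
  N≡0 = denom∣numer⇒numer≡0 s proper coprime (C.coprime-divisor (C.sym (coprime-denom b⊥s)) P∣bN)
  bP∣aP : b * P ∣ a * P
  bP∣aP = subst (b * P ∣_) (begin
    a * P + b * N ≡⟨ cong (λ N → a * P + b * N) N≡0 ⟩
    a * P + b * 0 ≡⟨ cong (a * P +_) (*-zeroʳ b) ⟩
    a * P + 0     ≡⟨ +-identityʳ (a * P) ⟩
    a * P         ∎) bP∣N
  a≡0 : a ≡ 0
  a≡0 = ∣-<⇒≡0 (*-cancelʳ-∣ P {{ℕ.>-nonZero (denom-pos (All.map (≤-trans (s≤s z≤n)) proper))}} bP∣aP) a<b

reweigh : (ℕ → ℕ → ℕ) → List ℕ → List (ℕ × ℕ) → List (ℕ × ℕ)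
reweigh f xs s = zipWith (λ x p → (f x (proj₁ p) , proj₂ p)) xs s

pick : List ℕ → List (ℕ × ℕ) → List (ℕ × ℕ)
pick = reweigh (λ x _ → x)

unpick : List ℕ → List (ℕ × ℕ) → List (ℕ × ℕ)
unpick = reweigh (λ x a → a ∸ x)

dens-reweigh : ∀ f {R : ℕ → ℕ × ℕ → Set} {xs s} → Pointwise R xs s → dens (reweigh f xs s) ≡ dens s
dens-reweigh f []                         = refl
dens-reweigh f {s = (_ , b) ∷ _} (_ ∷ rs) = cong (b ∷_) (dens-reweigh f rs)

denom-reweigh : ∀ f {R : ℕ → ℕ × ℕ → Set} {xs s} → Pointwise R xs s → denom (reweigh f xs s) ≡ denom s
denom-reweigh f rs = cong product (dens-reweigh f rs)

reweigh-∷ʳ : ∀ f {R : ℕ → ℕ × ℕ → Set} {xs s} x p → Pointwise R xs s →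
             reweigh f (xs ∷ʳ x) (s ∷ʳ p) ≡ reweigh f xs s ∷ʳ (f x (proj₁ p) , proj₂ p)
reweigh-∷ʳ f x p []                                   = refl
reweigh-∷ʳ f {xs = y ∷ _} {(a , b) ∷ _} x p (_ ∷ rs) = cong ((f y a , b) ∷_) (reweigh-∷ʳ f x p rs)

reweigh-proper : ∀ {f xs s} → (∀ {x a} → x ≤ a → f x a ≤ a) → Choice s xs → All Proper s →
                 All Proper (reweigh f xs s)
reweigh-proper f≤ []         []             = []
reweigh-proper f≤ (x≤a ∷ xs) (a<b ∷ proper) = ≤-<-trans (f≤ x≤a) a<b ∷ reweigh-proper f≤ xs proper

reweigh-coprime : ∀ f {xs s} → Choice s xs → AllPairs (Coprime on proj₂) s →
                  AllPairs (Coprime on proj₂) (reweigh f xs s)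
reweigh-coprime f xs coprime =
  AllPairsP.map⁻ (subst (AllPairs Coprime) (sym (dens-reweigh f xs)) (AllPairsP.map⁺ coprime))

numer-pick+unpick : ∀ {xs s} → Choice s xs → numer (pick xs s) + numer (unpick xs s) ≡ numer s
numer-pick+unpick []                                    = refl
numer-pick+unpick {x ∷ xs} {(a , b) ∷ s} (x≤a ∷ choice) = begin
  x * denom (pick xs s) + b * Nx + ((a ∸ x) * denom (unpick xs s) + b * Nd)
    ≡⟨ cong₂ (λ P P′ → x * P + b * Nx + ((a ∸ x) * P′ + b * Nd)) (denom-reweigh _ choice) (denom-reweigh _ choice) ⟩
  x * P + b * Nx + ((a ∸ x) * P + b * Nd)
    ≡⟨ solve 6 (λ x P b N d N′ → x :* P :+ b :* N :+ (d :* P :+ b :* N′) := (d :+ x) :* P :+ b :* (N :+ N′))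
         refl x P b Nx (a ∸ x) Nd ⟩
  (a ∸ x + x) * P + b * (Nx + Nd)
    ≡⟨ cong₂ (λ a N → a * P + b * N) (m∸n+n≡m x≤a) (numer-pick+unpick choice) ⟩
  a * P + b * numer s ∎
  where
  open ≡-Reasoning
  P  = denom s
  Nx = numer (pick xs s)
  Nd = numer (unpick xs s)

module Construction (m n W : ℕ) (1≤n : 1 ≤ n) (1≤W : 1 ≤ W) where

  instance
    _ = ℕ.>-nonZero 1≤n
    _ = ℕ.>-nonZero 1≤W

  M : List (ℕ × ℕ) → ℕ
  M s = n * denom s

  M-∷ : ∀ a b s → M ((a , b) ∷ s) ≡ b * M s
  M-∷ a b s = solve 3 (λ n b P → n :* (b :* P) := b :* (n :* P)) refl n b (denom s)

  -- m/n = value s + E / M s.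
  record Admissible (s : List (ℕ × ℕ)) (E : ℕ) : Set where
    field
      remainder : n * numer s + E ≡ m * denom s
      terms     : All (λ p → 1 ≤ proj₁ p × Proper p) s
      coprime   : AllPairs (Coprime on proj₂) s
      coprimeW  : All (λ p → Coprime (proj₂ p) W) s
  open Admissible

  proper : ∀ {s E} → Admissible s E → All Proper s
  proper adm = All.map proj₂ (terms adm)

  1≤denom : ∀ {s E} → Admissible s E → 1 ≤ denom s
  1≤denom adm = denom-pos (All.map (≤-trans (s≤s z≤n)) (proper adm))

  1≤M : ∀ {s E} → Admissible s E → 1 ≤ M s
  1≤M adm = *-mono-≤ 1≤n (1≤denom adm)

  extend : ∀ {s E} a b E′ → Admissible s E → 1 ≤ a → a < b → Coprime b (denom s) → Coprime b W →
           E′ + a * M s ≡ b * E → Admissible ((a , b) ∷ s) E′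
  extend {s} {E} a b E′ adm 1≤a a<b b⊥P b⊥W E′+aM≡bE = record
    { remainder = begin
        n * (a * P + b * N) + E′       ≡⟨ solve 6 (λ n a P b N E′ → n :* (a :* P :+ b :* N) :+ E′
                                                  := (E′ :+ a :* (n :* P)) :+ b :* (n :* N)) refl n a P b N E′ ⟩
        (E′ + a * M s) + b * (n * N)   ≡⟨ cong (_+ b * (n * N)) E′+aM≡bE ⟩
        b * E + b * (n * N)            ≡⟨ *-distribˡ-+ b E (n * N) ⟨
        b * (E + n * N)                ≡⟨ cong (b *_) (trans (+-comm E (n * N)) (remainder adm)) ⟩
        b * (m * P)                    ≡⟨ solve 3 (λ b m P → b :* (m :* P) := m :* (b :* P)) refl b m P ⟩
        m * (b * P)                    ∎
    ; terms    = (1≤a , a<b) ∷ terms adm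
    ; coprime  = coprime-denom⁻ s b⊥P ∷ coprime adm
    ; coprimeW = b⊥W ∷ coprimeW adm
    }
    where
    open ≡-Reasoning
    P = denom s
    N = numer s

  X : List (ℕ × ℕ) → ℕ
  X s = M s * W

  1+X⊥denom : ∀ s → Coprime (suc (X s)) (denom s)
  1+X⊥denom s = ≡1+⇒coprime refl (∣m⇒∣m*n W (n∣m*n n))

  1+X⊥W : ∀ s → Coprime (suc (X s)) W
  1+X⊥W s = ≡1+⇒coprime refl (n∣m*n (M s))

  -- 1 / M s − W / (1 + X s) = 1 / ((1 + X s) M s).
  neutral : ∀ {s} → Admissible s 1 → Admissible ((W , suc (X s)) ∷ s) 1
  neutral {s} adm = extend W (suc (X s)) 1 adm 1≤W W<1+X (1+X⊥denom s) (1+X⊥W s)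
    (solve 2 (λ W M → con 1 :+ W :* M := (con 1 :+ M :* W) :* con 1) refl W (M s))
    where
    W<1+X : W < suc (X s)
    W<1+X = s≤s (m≤n*m W (M s) {{ℕ.>-nonZero (1≤M adm)}})

  neutrals : ∀ R {s} → Admissible s 1 → ∃[ s′ ] Admissible s′ 1 × length s′ ≡ R + length s
  neutrals zero    adm = _ , adm , refl
  neutrals (suc R) adm with neutrals R adm
  ... | _ , adm′ , len = _ , neutral adm′ , cong suc len

  -- j is the integer part of the remainder E / M s.
  record Stage (s : List (ℕ × ℕ)) (j : ℕ) : Set where
    field
      r          : ℕ
      admissible : Admissible s (j * M s + r)
      r<M        : r < M s
      coprimeM   : Coprime (j * M s + r) (M s)
      positive   : 1 ≤ j * M s + r
  open Stage

  -- Subtracting X / (1 + X) = 1 − 1 / (1 + X) lowers the integer part j of the remainder by one.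
  filler : ∀ {s j} → Stage s (suc j) → Stage ((X s , suc (X s)) ∷ s) j
  filler {s} {j} st = record
    { r          = r′
    ; admissible = extend (X s) (suc (X s)) E′ (admissible st) 1≤X ≤-refl (1+X⊥denom s) (1+X⊥W s) E′+XM≡[1+X]E
    ; r<M        = subst (r′ <_) (sym (M-∷ (X s) (suc (X s)) s)) (filler-remainder-< (m≤m*n (M s) W) (r<M st))
    ; coprimeM   = subst (Coprime E′) (sym (M-∷ (X s) (suc (X s)) s)) (filler-coprime (m∣m*n W) (coprimeM st) E′+XM≡[1+X]E)
    ; positive   = ≤-trans (1≤M (admissible st)) (≤-trans (m≤m+n (M s) _) (m≤n+m r′ (j * M s′)))
    }
    where
    s′ = (X s , suc (X s)) ∷ s
    r′ = M s + suc (X s) * r st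
    E′ = j * M s′ + r′
    E′+XM≡[1+X]E : E′ + X s * M s ≡ suc (X s) * (suc j * M s + r st)
    E′+XM≡[1+X]E = trans (cong (λ M′ → j * M′ + r′ + X s * M s) (M-∷ (X s) (suc (X s)) s)) (filler-identity j (M s) (X s) (r st))
    1≤X : 1 ≤ X s
    1≤X = ≤-trans (1≤M (admissible st)) (m≤m*n (M s) W)

  fillers : ∀ j {s} → Stage s j → ∃[ s′ ] Stage s′ 0
  fillers zero    st = _ , st
  fillers (suc j) st = fillers j (filler st)

  finish : ∀ {s} → Stage s 0 → ∃[ s′ ] Admissible s′ 1
  finish {s} st with finalTerm (positive st) (r<M st) (coprimeM st) 1≤W
  ... | a , b , 1≤a , a<b , bE≡1+Ma , b⊥W =
    _ , extend a b 1 (admissible st) 1≤a a<b b⊥P b⊥W (trans (cong (1 +_) (*-comm a (M s))) (sym bE≡1+Ma))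
    where
    b⊥P : Coprime b (denom s)
    b⊥P = coprime-∣ˡ (m∣m*n (r st)) (≡1+⇒coprime bE≡1+Ma (∣m⇒∣m*n a (n∣m*n n)))

  initial : 1 ≤ m → Coprime m n → Stage [] (m / n)
  initial 1≤m m⊥n = record
    { r          = m % n
    ; admissible = record
        { remainder = trans (cong (n * 0 +_) E≡m) (solve 2 (λ n m → n :* con 0 :+ m := m :* con 1) refl n m)
        ; terms = [] ; coprime = [] ; coprimeW = [] }
    ; r<M        = subst (m % n <_) (sym (*-identityʳ n)) (m%n<n m n)
    ; coprimeM   = subst₂ Coprime (sym E≡m) (sym (*-identityʳ n)) m⊥n
    ; positive   = subst (1 ≤_) (sym E≡m) 1≤m
    }
    where
    E≡m : m / n * (n * 1) + m % n ≡ m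
    E≡m = trans (cong (λ n′ → m / n * n′ + m % n) (*-identityʳ n))
                (trans (+-comm (m / n * n) (m % n)) (sym (m≡m%n+[m/n]*n m n)))

  build : 1 ≤ m → Coprime m n → ∀ R → ∃[ s ] Admissible s 1 × R ≤ length s
  build 1≤m m⊥n R with fillers (m / n) (initial 1≤m m⊥n)
  ... | _ , st with finish st
  ... | _ , adm with neutrals R adm
  ... | s , adm′ , len = s , adm′ , subst (R ≤_) (sym len) (m≤m+n R _)

  denom⊥n : ∀ {s} → Admissible s 1 → Coprime (denom s) n
  denom⊥n {s} adm = coprime-∣ˡ (n∣m*n m)
    (≡1+⇒coprime (trans (sym (remainder adm)) (+-comm (n * numer s) 1)) (m∣m*n (numer s)))

  frac-completed≡m/n : ∀ {s} → Admissible s 1 → frac (numer s * M s + denom s * 1) (denom s * M s) ≡ frac m n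
  frac-completed≡m/n {s} adm = frac-cross (*-mono-≤ (1≤denom adm) (1≤M adm)) 1≤n (begin
    (N * (n * P) + P * 1) * n ≡⟨ solve 3 (λ N n P → (N :* (n :* P) :+ P :* con 1) :* n := P :* n :* (n :* N :+ con 1)) refl N n P ⟩
    P * n * (n * N + 1)       ≡⟨ cong (P * n *_) (remainder adm) ⟩
    P * n * (m * P)           ≡⟨ solve 3 (λ P n m → P :* n :* (m :* P) := m :* (P :* (n :* P))) refl P n m ⟩
    m * (P * (n * P))         ∎)
    where
    open ≡-Reasoning
    N = numer s
    P = denom s

  subValue-theDecomposition : ∀ {s xs y} → Admissible s 1 → Choice s xs →
    subValue (xs ∷ʳ y) (theDecomposition n s) ≡ frac (numer (pick xs s) * M s + denom s * y) (denom s * M s)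
  subValue-theDecomposition {s} {xs} {y} adm choice = begin
    value (pick (xs ∷ʳ y) (s ∷ʳ (1 , M s)))
      ≡⟨ cong value (reweigh-∷ʳ _ y (1 , M s) choice) ⟩
    value (pick xs s ∷ʳ (y , M s))
      ≡⟨ value-∷ʳ (All.map (≤-trans (s≤s z≤n)) (reweigh-proper id choice (proper adm))) (1≤M adm) ⟩
    frac (numer (pick xs s) * M s + denom (pick xs s) * y) (denom (pick xs s) * M s)
      ≡⟨ cong (λ P → frac (numer (pick xs s) * M s + P * y) (P * M s)) (denom-reweigh _ choice) ⟩
    frac (numer (pick xs s) * M s + denom s * y) (denom s * M s) ∎
    where open ≡-Reasoning

  ∈ℤ/n⇒denom∣ : ∀ {s N y k} → Admissible s 1 →
                frac (N * M s + denom s * y) (denom s * M s) ≡ fracℤ k n → denom s ∣ n * N + y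
  ∈ℤ/n⇒denom∣ {s} {N} {y} {k} adm v≡k/n =
    divides ℤ.∣ k ∣ (*-cancelʳ-≡ _ _ (P * n) {{ℕ.>-nonZero (*-mono-≤ (1≤denom adm) 1≤n)}} (begin
      (n * N + y) * (P * n)     ≡⟨ solve 4 (λ n N y P → (n :* N :+ y) :* (P :* n) := (N :* (n :* P) :+ P :* y) :* n) refl n N y P ⟩
      (N * (n * P) + P * y) * n ≡⟨ frac≡fracℤ⇒cross (*-mono-≤ (1≤denom adm) (1≤M adm)) 1≤n v≡k/n ⟩
      ℤ.∣ k ∣ * (P * (n * P))   ≡⟨ solve 3 (λ k P n → k :* (P :* (n :* P)) := k :* P :* (P :* n)) refl (ℤ.∣ k ∣) P n ⟩
      ℤ.∣ k ∣ * P * (P * n)     ∎))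
    where
    open ≡-Reasoning
    P = denom s

  reweigh-vanishes : ∀ f {s xs} → (∀ {x a} → x ≤ a → f x a ≤ a) → Admissible s 1 → Choice s xs →
                     denom s ∣ n * numer (reweigh f xs s) → numer (reweigh f xs s) ≡ 0
  reweigh-vanishes f {s} {xs} f≤ adm choice P∣nN =
    denom∣numer⇒numer≡0 _ (reweigh-proper f≤ choice (proper adm)) (reweigh-coprime f choice (coprime adm))
      (subst (_∣ numer (reweigh f xs s)) (sym (denom-reweigh f choice)) (C.coprime-divisor (denom⊥n adm) P∣nN))

  faithful-lastOmitted : ∀ {s xs} → Admissible s 1 → Choice s xs →
                         InOneOverNZ n (subValue (xs ∷ʳ 0) (theDecomposition n s)) →
                         subValue (xs ∷ʳ 0) (theDecomposition n s) ≡ 0ℚ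
  faithful-lastOmitted {s} {xs} adm choice (k , v≡k/n) = begin
    subValue (xs ∷ʳ 0) (theDecomposition n s)        ≡⟨ subValue-theDecomposition adm choice ⟩
    frac (numer (pick xs s) * M s + P * 0) (P * M s) ≡⟨ cong₂ (λ N z → frac (N * M s + z) (P * M s)) picked≡0 (*-zeroʳ P) ⟩
    frac 0 (P * M s)                                 ≡⟨ frac-0 (*-mono-≤ (1≤denom adm) (1≤M adm)) ⟩
    0ℚ                                               ∎
    where
    open ≡-Reasoning
    P = denom s
    picked≡0 : numer (pick xs s) ≡ 0
    picked≡0 = reweigh-vanishes _ id adm choice (subst (P ∣_) (+-identityʳ _)
                 (∈ℤ/n⇒denom∣ adm (trans (sym (subValue-theDecomposition adm choice)) v≡k/n)))

  faithful-lastIncluded : ∀ {s xs} → Admissible s 1 → Choice s xs →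
                          InOneOverNZ n (subValue (xs ∷ʳ 1) (theDecomposition n s)) →
                          subValue (xs ∷ʳ 1) (theDecomposition n s) ≡ frac m n
  faithful-lastIncluded {s} {xs} adm choice (k , v≡k/n) = begin
    subValue (xs ∷ʳ 1) (theDecomposition n s)        ≡⟨ subValue-theDecomposition adm choice ⟩
    frac (numer (pick xs s) * M s + P * 1) (P * M s) ≡⟨ cong (λ N → frac (N * M s + P * 1) (P * M s)) picked≡all ⟩
    frac (numer s * M s + P * 1) (P * M s)           ≡⟨ frac-completed≡m/n adm ⟩
    frac m n                                         ∎
    where
    open ≡-Reasoning
    P  = denom s
    Nx = numer (pick xs s)
    Nd = numer (unpick xs s)
    total : n * Nx + 1 + n * Nd ≡ m * P
    total = begin
      n * Nx + 1 + n * Nd ≡⟨ solve 3 (λ n a b → n :* a :+ con 1 :+ n :* b := n :* (a :+ b) :+ con 1) refl n Nx Nd ⟩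
      n * (Nx + Nd) + 1   ≡⟨ cong (λ N → n * N + 1) (numer-pick+unpick choice) ⟩
      n * numer s + 1     ≡⟨ remainder adm ⟩
      m * P               ∎
    unpicked≡0 : Nd ≡ 0
    unpicked≡0 = reweigh-vanishes _ (λ {x} {a} _ → m∸n≤m a x) adm choice
      (∣m+n∣m⇒∣n (subst (P ∣_) (sym total) (n∣m*n m))
                 (∈ℤ/n⇒denom∣ adm (trans (sym (subValue-theDecomposition adm choice)) v≡k/n)))
    picked≡all : Nx ≡ numer s
    picked≡all = begin
      Nx      ≡⟨ +-identityʳ Nx ⟨
      Nx + 0  ≡⟨ cong (Nx +_) unpicked≡0 ⟨
      Nx + Nd ≡⟨ numer-pick+unpick choice ⟩
      numer s ∎

  faithful : ∀ {s} → Admissible s 1 → ∀ xs → Choice (theDecomposition n s) xs →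
             InOneOverNZ n (subValue xs (theDecomposition n s)) →
             subValue xs (theDecomposition n s) ≡ frac m n ⊎ subValue xs (theDecomposition n s) ≡ 0ℚ
  faithful {s} adm _ choice integral with Pointwise-∷ʳ⁻ s choice
  ... | _ , 0           , refl , choice′ , _    = inj₂ (faithful-lastOmitted adm choice′ integral)
  ... | _ , 1           , refl , choice′ , _    = inj₁ (faithful-lastIncluded adm choice′ integral)
  ... | _ , suc (suc _) , _    , _       , s≤s ()

  distinctDenominators : ∀ {s} → Admissible s 1 → 2 ≤ length s → Unique (map proj₂ (theDecomposition n s))
  distinctDenominators {_ ∷ []} _ (s≤s ())
  distinctDenominators {s@(_ ∷ _ ∷ _)} adm _ = subst Unique (sym (map-++ proj₂ s _))
    (AllPairsP.++⁺ (coprime⇒distinct 2≤dens (coprime adm)) ([] ∷ []) (All.map (λ b<M → <⇒≢ b<M ∷ []) dens<M))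
    where
    2≤dens : All ((2 ≤_) ∘ proj₂) s
    2≤dens = All.map (λ (1≤a , a<b) → ≤-trans (s≤s 1≤a) a<b) (terms adm)
    dens<M : All (_< M s) (dens s)
    dens<M = All.tabulate (λ b∈ → <-≤-trans (∈⇒<product (AllP.map⁺ 2≤dens) b∈) (m≤n*m (denom s) n))

  goodChoice : ∀ {Ω s} → All (_∣ W) Ω → Admissible s 1 → 2 ≤ length s → GoodChoice m n Ω s
  goodChoice {s = s} Ω∣W adm 2≤len =
    ≤-trans (s≤s z≤n) 2≤len ,
    terms adm ,
    ((positive-D , distinctDenominators adm 2≤len , value-D) , faithful adm) ,
    AllPairs-lookup C.sym (coprime adm) ,
    λ i → All.map (coprime-∣W i) Ω∣W
    where
    coprime-∣W : ∀ i {ω} → ω ∣ W → Coprime (proj₂ (lookup s i)) ω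
    coprime-∣W i ω∣W = coprime-∣ʳ ω∣W (All.lookup (coprimeW adm) (∈-lookup i))
    positive-D : All (λ p → 1 ≤ proj₁ p × 1 ≤ proj₂ p) (theDecomposition n s)
    positive-D = AllP.++⁺ (All.map (λ (1≤a , a<b) → 1≤a , ≤-trans (s≤s z≤n) a<b) (terms adm)) ((≤-refl , 1≤M adm) ∷ [])
    value-D : value (theDecomposition n s) ≡ frac m n
    value-D = trans (value-∷ʳ (All.map (≤-trans (s≤s z≤n)) (proper adm)) (1≤M adm)) (frac-completed≡m/n adm)

proposition4p1 : (m n : ℕ) → 1 ≤ m → 1 ≤ n → Coprime m n →
    (Ω : List ℕ) → All (λ ω → 1 ≤ ω) Ω →
    Infinite (GoodChoice m n Ω)
proposition4p1 m n 1≤m 1≤n m⊥n Ω 1≤Ω = unboundedLength⇒Infinite λ R →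
  let s , adm , 2+R≤len = build 1≤m m⊥n (2 + R)
  in s , ≤-trans (m≤n+m R 2) 2+R≤len , goodChoice (All.tabulate ∈⇒∣product) adm (≤-trans (m≤m+n 2 R) 2+R≤len)
  where
  1≤W : 1 ≤ product Ω
  1≤W = ℕ.>-nonZero⁻¹ _ {{product≢0 (All.map ℕ.>-nonZero 1≤Ω)}}
  open Construction m n (product Ω) 1≤n 1≤W
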